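{- There exists $\tau_0>0$ such that for all $\nu,\tau$ with $0<\nu\le\tau\le\tau_0$ and $\nu\le 1/2$ there exists $m_0$ such that for all $m\ge m_0$ the following holds. Let $G$ be an undirected bipartite graph with bipartition $A,B$, where $A=\{a_1,\dots,a_m\}$ and $B=\{b_1,\dots,b_m\}$. If $G$ is a bipartite robust $(\nu,\tau)$-expander with bipartition $A,B$, then the digraph $H$ with vertex set $A$ and edge set $\{a_ia_j: a_ib_j\in E(G),\ i\ne j\}$ is a robust $(\nu/2,2\tau)$-outexpander.
   Context: For an undirected graph $G$ on $N$ vertices and $S\subseteq V(G)$, the $\nu$-robust neighbourhood $RN_{\nu,G}(S)$ is the set of vertices with at least $\nu N$ neighbours in $S$. A bipartite graph $G$ on $N$ vertices with bipartition $A,B$ is a bipartite robust $(\nu,\tau)$-expander with bipartition $A,B$ if every $S\subseteq A$ with $\tau|A|\le|S|\le(1-\tau)|A|$ satisfies $|RN_{\nu,G}(S)\cap B|\ge |S|+\nu N$. For a digraph $H$ on $N$ vertices and $S\subseteq V(H)$, the $\nu$-robust outneighbourhood $RN^+_{\nu,H}(S)$ is the set of vertices with at least $\nu N$ inneighbours in $S$; $H$ is a robust $(\nu,\tau)$-outexpander if every $S\subseteq V(H)$ with $\tau N\le |S|\le(1-\tau)N$ satisfies $|RN^+_{\nu,H}(S)|\ge |S|+\nu N$.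
   Formalization: The parameters ν and τ range only over the rationals, and $\tau_0$ is taken in the rationals as well. -}

module Defs where

open import Data.Bool using (Bool; true; false; _∧_; not; T)
open import Data.Nat as ℕ using (ℕ; _+_)
open import Data.Integer using (+_)
open import Data.Fin using (Fin; _≟_; _↑ˡ_; _↑ʳ_)
open import Data.Fin.Subset using (Subset; ∣_∣; _∩_; _⊆_; _∈_; _∉_)
open import Data.Vec using (tabulate; replicate; _++_)
open import Data.Rational using (ℚ; _*_; _≤_; _≤ᵇ_; 1ℚ; _-_)
open import Relation.Binary.PropositionalEquality using (_≡_)
open import Relation.Nullary.Decidable using (⌊_⌋)

ℕ→ℚ : ℕ → ℚ
ℕ→ℚ n = + n Data.Rational./ 1

record Graph (N : ℕ) : Set where
  field
    adj     : Fin N → Fin N → Bool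
    adj-sym : ∀ u v → adj u v ≡ adj v u
    loopless : ∀ v → adj v v ≡ false
open Graph public

-- A digraph on vertex set Fin N: adj u v = true means there is an edge u → v.
Digraph : ℕ → Set
Digraph N = Fin N → Fin N → Bool

degIn : ∀ {N} → Graph N → Subset N → Fin N → ℕ
degIn G S v = ∣ S ∩ tabulate (λ u → adj G u v) ∣

indegIn : ∀ {N} → Digraph N → Subset N → Fin N → ℕ
indegIn H S v = ∣ S ∩ tabulate (λ u → H u v) ∣

RN : ∀ {N} → ℚ → Graph N → Subset N → Subset N
RN {N} ν G S = tabulate (λ v → (ν * ℕ→ℚ N) ≤ᵇ ℕ→ℚ (degIn G S v))

RN⁺ : ∀ {N} → ℚ → Digraph N → Subset N → Subset N
RN⁺ {N} ν H S = tabulate (λ v → (ν * ℕ→ℚ N) ≤ᵇ ℕ→ℚ (indegIn H S v))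

IsBipartition : ∀ {N} → Graph N → Subset N → Subset N → Set
IsBipartition {N} G A B =
  (∀ v → (v ∈ A × v ∉ B) ⊎ (v ∉ A × v ∈ B)) ×
  (∀ u v → T (adj G u v) → (u ∈ A × v ∈ B) ⊎ (u ∈ B × v ∈ A))
  where open import Data.Product using (_×_)
        open import Data.Sum using (_⊎_)

-- bipartite robust (ν,τ)-expander with bipartition A,B
-- (the bipartiteness of G w.r.t. A,B is a separate hypothesis, IsBipartition)
BipRobustExpander : ∀ {N} → ℚ → ℚ → Graph N → Subset N → Subset N → Set
BipRobustExpander {N} ν τ G A B =
  ∀ (S : Subset N) → S ⊆ A →
    τ * ℕ→ℚ ∣ A ∣ ≤ ℕ→ℚ ∣ S ∣ →
    ℕ→ℚ ∣ S ∣ ≤ (1ℚ - τ) * ℕ→ℚ ∣ A ∣ →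
    ℕ→ℚ ∣ S ∣ Data.Rational.+ ν * ℕ→ℚ N ≤ ℕ→ℚ ∣ RN ν G S ∩ B ∣

RobustOutexpander : ∀ {N} → ℚ → ℚ → Digraph N → Set
RobustOutexpander {N} ν τ H =
  ∀ (S : Subset N) →
    τ * ℕ→ℚ N ≤ ℕ→ℚ ∣ S ∣ →
    ℕ→ℚ ∣ S ∣ ≤ (1ℚ - τ) * ℕ→ℚ N →
    ℕ→ℚ ∣ S ∣ Data.Rational.+ ν * ℕ→ℚ N ≤ ℕ→ℚ ∣ RN⁺ ν H S ∣

-- Vertex set of G is Fin (m + m): a_i = inject+ m i, b_j = raise m j.
vA : ∀ {m} → Fin m → Fin (m + m)
vA {m} i = i ↑ˡ m

vB : ∀ {m} → Fin m → Fin (m + m)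
vB {m} j = m ↑ʳ j

setA : ∀ m → Subset (m + m)
setA m = replicate m true ++ replicate m false

setB : ∀ m → Subset (m + m)
setB m = replicate m false ++ replicate m true

auxDigraph : ∀ m → Graph (m + m) → Digraph m
auxDigraph m G i j = adj G (vA i) (vB j) ∧ not ⌊ i ≟ j ⌋

module Submission where

-- A set S ⊆ A of size s in the 2τ-window is also in the τ-window, so robust expansion of G yields
-- s + 2νm vertices b_j with at least 2νm neighbours in S. The inneighbours of a_j in H are the
-- neighbours of b_j in S except possibly a_j itself, so each such a_j has at least 2νm − 1 ≥ νm/2
-- inneighbours in S as soon as νm ≥ 1, which holds once m is at least the denominator of ν.

module SubsetCounting where

  open import Data.Bool using (Bool; _∧_; not; T)
  open import Data.Bool.Properties using (T-∧; T-≡)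
  open import Data.Nat as ℕ using (ℕ; zero; suc; _+_; s≤s)
  open import Data.Nat.Properties as ℕ using (≤-refl; n≤1+n; +-identityʳ)
  open import Data.Fin using (Fin; zero; suc; _≟_; _↑ˡ_; _↑ʳ_)
  open import Data.Fin.Properties using (suc-injective)
  open import Data.Fin.Subset
  open import Data.Fin.Subset.Properties
  open import Data.Vec using ([]; _∷_; tabulate; _++_; here; there)
  open import Data.Vec.Properties using (lookup∘tabulate; []=⇒lookup; lookup⇒[]=; zipWith-++)
  open import Data.Product using (_,_)
  open import Function using (_∘_; Equivalence)
  open import Relation.Binary.PropositionalEquality
  open import Relation.Nullary.Decidable using (⌊_⌋; fromWitnessFalse)

  open Equivalence using (to; from)

  private variable
    m n : ℕ

  tabulate-++ : ∀ {A : Set} m {n} (f : Fin (m + n) → A) →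
                tabulate f ≡ tabulate (f ∘ (_↑ˡ n)) ++ tabulate (f ∘ (m ↑ʳ_))
  tabulate-++ zero    f = refl
  tabulate-++ (suc m) f = cong (f zero ∷_) (tabulate-++ m (f ∘ suc))

  ∣p++q∣≡∣p∣+∣q∣ : ∀ (p : Subset m) (q : Subset n) → ∣ p ++ q ∣ ≡ ∣ p ∣ + ∣ q ∣
  ∣p++q∣≡∣p∣+∣q∣ []            q = refl
  ∣p++q∣≡∣p∣+∣q∣ (outside ∷ p) q = ∣p++q∣≡∣p∣+∣q∣ p q
  ∣p++q∣≡∣p∣+∣q∣ (inside  ∷ p) q = cong suc (∣p++q∣≡∣p∣+∣q∣ p q)

  ∣p++⊥∣≡∣p∣ : ∀ (p : Subset m) → ∣ p ++ ⊥ {n} ∣ ≡ ∣ p ∣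
  ∣p++⊥∣≡∣p∣ {n = n} p = trans (∣p++q∣≡∣p∣+∣q∣ p ⊥) (trans (cong (∣ p ∣ +_) (∣⊥∣≡0 n)) (+-identityʳ ∣ p ∣))

  p++⊥⊆⊤++⊥ : ∀ (p : Subset m) → p ++ ⊥ {n} ⊆ ⊤ {m} ++ ⊥
  p++⊥⊆⊤++⊥ []      x∈⊥       = x∈⊥
  p++⊥⊆⊤++⊥ (_ ∷ p) here      = here
  p++⊥⊆⊤++⊥ (_ ∷ p) (there x) = there (p++⊥⊆⊤++⊥ p x)

  infix 4 _⊆_except_
  _⊆_except_ : Subset n → Subset n → Fin n → Set
  p ⊆ q except x = ∀ {y} → y ∈ p → y ≢ x → y ∈ q

  drop-∷-except : ∀ {s t} {p q : Subset n} {x} → s ∷ p ⊆ t ∷ q except suc x → p ⊆ q except x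
  drop-∷-except p⊆q y∈p y≢x = drop-there (p⊆q (there y∈p) (y≢x ∘ suc-injective))

  ∣x∷p∣≤1+∣p∣ : ∀ s (p : Subset n) → ∣ s ∷ p ∣ ℕ.≤ suc ∣ p ∣
  ∣x∷p∣≤1+∣p∣ outside p = n≤1+n ∣ p ∣
  ∣x∷p∣≤1+∣p∣ inside  p = ≤-refl

  ⊆-except⇒∣p∣≤1+∣q∣ : ∀ {p q : Subset n} x → p ⊆ q except x → ∣ p ∣ ℕ.≤ suc ∣ q ∣
  ⊆-except⇒∣p∣≤1+∣q∣ {p = s ∷ p} {t ∷ q} zero p⊆q =
    ℕ.≤-trans (∣x∷p∣≤1+∣p∣ s p) (s≤s (ℕ.≤-trans (p⊆q⇒∣p∣≤∣q∣ tail⊆) (∣p∣≤∣x∷p∣ t q)))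
    where
    tail⊆ : p ⊆ q
    tail⊆ y∈p = drop-there (p⊆q (there y∈p) λ ())
  ⊆-except⇒∣p∣≤1+∣q∣ {p = outside ∷ p} {t ∷ q} (suc x) p⊆q =
    ℕ.≤-trans (⊆-except⇒∣p∣≤1+∣q∣ x (drop-∷-except p⊆q)) (s≤s (∣p∣≤∣x∷p∣ t q))
  ⊆-except⇒∣p∣≤1+∣q∣ {p = inside ∷ p} {t ∷ q} (suc x) p⊆q with p⊆q here (λ ())
  ... | here = s≤s (⊆-except⇒∣p∣≤1+∣q∣ x (drop-∷-except p⊆q))

  x∈tabulate⁺ : ∀ {f : Fin n → Bool} {x} → T (f x) → x ∈ tabulate f
  x∈tabulate⁺ {f = f} {x} t = lookup⇒[]= x (tabulate f) (trans (lookup∘tabulate f x) (to T-≡ t))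

  x∈tabulate⁻ : ∀ {f : Fin n → Bool} {x} → x ∈ tabulate f → T (f x)
  x∈tabulate⁻ {f = f} {x} x∈ = from T-≡ (trans (sym (lookup∘tabulate f x)) ([]=⇒lookup x∈))

  tabulate-⊆ : ∀ {f g : Fin n → Bool} → (∀ x → T (f x) → T (g x)) → tabulate f ⊆ tabulate g
  tabulate-⊆ f⇒g x∈ = x∈tabulate⁺ (f⇒g _ (x∈tabulate⁻ x∈))

  ∣p∩tabulate-f∣≤1+∣p∩tabulate-f∧≢x∣ : ∀ (p : Subset n) (f : Fin n → Bool) x →
    ∣ p ∩ tabulate f ∣ ℕ.≤ suc ∣ p ∩ tabulate (λ i → f i ∧ not ⌊ i ≟ x ⌋) ∣
  ∣p∩tabulate-f∣≤1+∣p∩tabulate-f∧≢x∣ p f x = ⊆-except⇒∣p∣≤1+∣q∣ x ⊆except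
    where
    ⊆except : p ∩ tabulate f ⊆ p ∩ tabulate (λ i → f i ∧ not ⌊ i ≟ x ⌋) except x
    ⊆except y∈ y≢x =
      let y∈p , y∈f = x∈p∩q⁻ p (tabulate f) y∈
      in x∈p∩q⁺ (y∈p , x∈tabulate⁺ (from T-∧ (x∈tabulate⁻ y∈f , fromWitnessFalse y≢x)))

  ∣p++⊥∩tabulate∣ : ∀ (p : Subset m) (f : Fin (m + n) → Bool) →
    ∣ (p ++ ⊥) ∩ tabulate f ∣ ≡ ∣ p ∩ tabulate (f ∘ (_↑ˡ n)) ∣
  ∣p++⊥∩tabulate∣ {m} {n} p f = begin
    ∣ (p ++ ⊥) ∩ tabulate f ∣        ≡⟨ cong (∣_∣ ∘ ((p ++ ⊥) ∩_)) (tabulate-++ m f) ⟩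
    ∣ (p ++ ⊥) ∩ (lo ++ hi) ∣        ≡⟨ cong ∣_∣ (zipWith-++ _∧_ p ⊥ lo hi) ⟩
    ∣ (p ∩ lo) ++ (⊥ ∩ hi) ∣         ≡⟨ cong (λ u → ∣ p ∩ lo ++ u ∣) (∩-zeroˡ hi) ⟩
    ∣ (p ∩ lo) ++ ⊥ {n} ∣            ≡⟨ ∣p++⊥∣≡∣p∣ (p ∩ lo) ⟩
    ∣ p ∩ lo ∣                       ∎
    where
    open ≡-Reasoning
    lo = tabulate (f ∘ (_↑ˡ n))
    hi = tabulate (f ∘ (m ↑ʳ_))

  ∣tabulate∩⊥++⊤∣ : ∀ (f : Fin (m + n) → Bool) →
    ∣ tabulate f ∩ (⊥ {m} ++ ⊤ {n}) ∣ ≡ ∣ tabulate (f ∘ (m ↑ʳ_)) ∣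
  ∣tabulate∩⊥++⊤∣ {m} {n} f = begin
    ∣ tabulate f ∩ B ∣               ≡⟨ cong (∣_∣ ∘ (_∩ B)) (tabulate-++ m f) ⟩
    ∣ (lo ++ hi) ∩ B ∣               ≡⟨ cong ∣_∣ (zipWith-++ _∧_ lo hi ⊥ ⊤) ⟩
    ∣ (lo ∩ ⊥) ++ (hi ∩ ⊤) ∣         ≡⟨ cong₂ (λ u v → ∣ u ++ v ∣) (∩-zeroʳ lo) (∩-identityʳ hi) ⟩
    ∣ ⊥ {m} ++ hi ∣                  ≡⟨ ∣p++q∣≡∣p∣+∣q∣ (⊥ {m}) hi ⟩
    ∣ ⊥ {m} ∣ + ∣ hi ∣               ≡⟨ cong (_+ ∣ hi ∣) (∣⊥∣≡0 m) ⟩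
    ∣ hi ∣                           ∎
    where
    open ≡-Reasoning
    lo = tabulate (f ∘ (_↑ˡ n))
    hi = tabulate (f ∘ (m ↑ʳ_))
    B = ⊥ {m} ++ ⊤ {n}


module RationalArithmetic where

  open import Defs using (ℕ→ℚ)
  open import Data.Nat as ℕ using (zero; suc; z≤n)
  import Data.Nat.Properties as ℕ
  import Data.Nat.Coprimality as Coprime
  open import Data.Integer as ℤ using (+_; +≤+; +<+)
  import Data.Integer.Properties as ℤ
  open import Data.Rational
  open import Data.Rational.Properties
  import Data.Rational.Unnormalised as ℚᵘ
  import Data.Rational.Unnormalised.Properties as ℚᵘ
  open import Function using (_∘_)
  open import Relation.Binary.PropositionalEquality

  ℕ→ℚ≡mkℚ : ∀ n → ℕ→ℚ n ≡ mkℚ (+ n) 0 (Coprime.sym (Coprime.1-coprimeTo n))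
  ℕ→ℚ≡mkℚ n = normalize-coprime _

  ℕ→ℚ-mono-≤ : ∀ {a b} → a ℕ.≤ b → ℕ→ℚ a ≤ ℕ→ℚ b
  ℕ→ℚ-mono-≤ {a} {b} a≤b rewrite ℕ→ℚ≡mkℚ a | ℕ→ℚ≡mkℚ b = *≤* (ℤ.*-monoʳ-≤-nonNeg (+ 1) (+≤+ a≤b))

  0≤ℕ→ℚ : ∀ n → 0ℚ ≤ ℕ→ℚ n
  0≤ℕ→ℚ n = ℕ→ℚ-mono-≤ {0} {n} z≤n

  ℕ→ℚ-+ : ∀ a b → ℕ→ℚ (a ℕ.+ b) ≡ ℕ→ℚ a + ℕ→ℚ b
  ℕ→ℚ-+ a b = toℚᵘ-injective (begin
    toℚᵘ (ℕ→ℚ (a ℕ.+ b))                ≡⟨ cong toℚᵘ (ℕ→ℚ≡mkℚ (a ℕ.+ b)) ⟩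
    ℚᵘ.mkℚᵘ (+ (a ℕ.+ b)) 0             ≈⟨ ℚᵘ.*≡* numerators ⟩
    ℚᵘ.mkℚᵘ (+ a) 0 ℚᵘ.+ ℚᵘ.mkℚᵘ (+ b) 0 ≡⟨ cong₂ (λ p q → toℚᵘ p ℚᵘ.+ toℚᵘ q) (ℕ→ℚ≡mkℚ a) (ℕ→ℚ≡mkℚ b) ⟨
    toℚᵘ (ℕ→ℚ a) ℚᵘ.+ toℚᵘ (ℕ→ℚ b)      ≈⟨ toℚᵘ-homo-+ (ℕ→ℚ a) (ℕ→ℚ b) ⟨
    toℚᵘ (ℕ→ℚ a + ℕ→ℚ b)                ∎)
    where
    open ℚᵘ.≃-Reasoning
    numerators : + (a ℕ.+ b) ℤ.* + 1 ≡ (+ a ℤ.* + 1 ℤ.+ + b ℤ.* + 1) ℤ.* + 1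
    numerators rewrite ℤ.*-identityʳ (+ a) | ℤ.*-identityʳ (+ b) = cong (ℤ._* + 1) (ℤ.pos-+ a b)

  +-cancelˡ-≤ : ∀ r {p q} → r + p ≤ r + q → p ≤ q
  +-cancelˡ-≤ r {p} {q} r+p≤r+q = subst₂ _≤_ (cancel p) (cancel q) (+-monoʳ-≤ (- r) r+p≤r+q)
    where
    cancel : ∀ x → - r + (r + x) ≡ x
    cancel x = trans (sym (+-assoc (- r) r x)) (trans (cong (_+ x) (+-inverseˡ r)) (+-identityˡ x))

  p*½≤p : ∀ {p} → 0ℚ ≤ p → p * ½ ≤ p
  p*½≤p {p} 0≤p = ≤-trans (*-monoˡ-≤-nonNeg p {{nonNegative 0≤p}} (≤ᵇ⇒≤ {½} {1ℚ} _)) (≤-reflexive (*-identityʳ p))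

  p≤2*p : ∀ {p} → 0ℚ ≤ p → p ≤ (+ 2 / 1) * p
  p≤2*p {p} 0≤p = ≤-trans (≤-reflexive (sym (*-identityˡ p))) (*-monoʳ-≤-nonNeg p {{nonNegative 0≤p}} (≤ᵇ⇒≤ {1ℚ} {+ 2 / 1} _))

  p+p≤1+q⇒p≤q : ∀ {p q} → 1ℚ ≤ p → p + p ≤ 1ℚ + q → p ≤ q
  p+p≤1+q⇒p≤q {p} 1≤p p+p≤1+q = +-cancelˡ-≤ 1ℚ (≤-trans (+-monoˡ-≤ p 1≤p) p+p≤1+q)

  -- A positive rational has numerator at least 1, so p ≥ 1 / ↧ₙ p.
  1≤p*n : ∀ p n → 0ℚ < p → ↧ₙ p ℕ.≤ n → 1ℚ ≤ p * ℕ→ℚ n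
  1≤p*n p@(mkℚ (+ suc k) d-1 _) n _ ↧p≤n rewrite ℕ→ℚ≡mkℚ n =
    toℚᵘ-cancel-≤ (ℚᵘ.≤-respʳ-≃ (ℚᵘ.≃-sym (toℚᵘ-homo-* p (mkℚ (+ n) 0 (Coprime.sym (Coprime.1-coprimeTo n))))) (ℚᵘ.*≤* cross))
    where
    cross : + 1 ℤ.* + suc (d-1 ℕ.* 1) ℤ.≤ (+ suc k ℤ.* + n) ℤ.* + 1
    cross = begin
      + 1 ℤ.* + suc (d-1 ℕ.* 1)   ≡⟨ ℤ.*-identityˡ _ ⟩
      + suc (d-1 ℕ.* 1)           ≡⟨ cong (+_ ∘ suc) (ℕ.*-identityʳ d-1) ⟩
      + suc d-1                   ≤⟨ +≤+ (ℕ.≤-trans ↧p≤n (ℕ.m≤n*m n (suc k))) ⟩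
      + (suc k ℕ.* n)             ≡⟨ ℤ.pos-* (suc k) n ⟩
      + suc k ℤ.* + n             ≡⟨ ℤ.*-identityʳ _ ⟨
      (+ suc k ℤ.* + n) ℤ.* + 1   ∎
      where open ℤ.≤-Reasoning
  1≤p*n (mkℚ (+ zero) _ _) _ (*<* (+<+ ()))
  1≤p*n (mkℚ ℤ.-[1+ _ ] _ _) _ (*<* ())

module RobustNeighbourhoods where

  open import Defs
  import Data.Integer as ℤ
  open import Data.Nat as ℕ using (suc)
  open import Data.Nat.Properties as ℕ using (m≤m+n)
  open import Data.Fin.Subset using (Subset; ∣_∣; _∩_; ⊥; ⊤)
  open import Data.Fin.Subset.Properties using (p⊆q⇒∣p∣≤∣q∣; ∣⊤∣≡n)
  open import Data.Product using (_×_; _,_; proj₁; proj₂)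
  open import Data.Vec using (tabulate; _++_)
  open import Data.Rational using (0ℚ; 1ℚ; ½; _<_; _≤_; _+_; _-_; _*_; _/_; _≤ᵇ_; ↧ₙ_; nonNegative)
  open import Data.Rational.Properties
  open import Function using (_∘_)
  open import Relation.Binary.PropositionalEquality
  open SubsetCounting
  open RationalArithmetic

  liftA : ∀ {m} → Subset m → Subset (m ℕ.+ m)
  liftA S = S ++ ⊥

  halve-*-≤ : ∀ {p q} → 0ℚ ≤ p → 0ℚ ≤ q → (p * ½) * q ≤ p * q
  halve-*-≤ {q = q} 0≤p 0≤q = *-monoʳ-≤-nonNeg q {{nonNegative 0≤q}} (p*½≤p 0≤p)

  halved-threshold : ∀ {ν m d k} → 0ℚ ≤ ν → 1ℚ ≤ ν * ℕ→ℚ m →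
    ν * ℕ→ℚ (m ℕ.+ m) ≤ ℕ→ℚ d → d ℕ.≤ suc k → (ν * ½) * ℕ→ℚ m ≤ ℕ→ℚ k
  halved-threshold {ν} {m} {d} {k} 0≤ν 1≤νm νN≤d d≤1+k =
    ≤-trans (halve-*-≤ 0≤ν (0≤ℕ→ℚ m)) (p+p≤1+q⇒p≤q 1≤νm 2νm≤1+k)
    where
    2νm≤1+k : ν * ℕ→ℚ m + ν * ℕ→ℚ m ≤ 1ℚ + ℕ→ℚ k
    2νm≤1+k = begin
      ν * ℕ→ℚ m + ν * ℕ→ℚ m  ≡⟨ *-distribˡ-+ ν (ℕ→ℚ m) (ℕ→ℚ m) ⟨
      ν * (ℕ→ℚ m + ℕ→ℚ m)    ≡⟨ cong (ν *_) (ℕ→ℚ-+ m m) ⟨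
      ν * ℕ→ℚ (m ℕ.+ m)      ≤⟨ νN≤d ⟩
      ℕ→ℚ d                  ≤⟨ ℕ→ℚ-mono-≤ d≤1+k ⟩
      ℕ→ℚ (1 ℕ.+ k)          ≡⟨ ℕ→ℚ-+ 1 k ⟩
      1ℚ + ℕ→ℚ k             ∎
      where open ≤-Reasoning

  degIn-vB≤1+indegIn : ∀ {m} (G : Graph (m ℕ.+ m)) (S : Subset m) j →
    degIn G (liftA S) (vB j) ℕ.≤ suc (indegIn (auxDigraph m G) S j)
  degIn-vB≤1+indegIn {m} G S j = begin
    degIn G (liftA S) (vB j)                     ≡⟨ ∣p++⊥∩tabulate∣ S (λ u → adj G u (vB j)) ⟩
    ∣ S ∩ tabulate (λ i → adj G (vA i) (vB j)) ∣ ≤⟨ ∣p∩tabulate-f∣≤1+∣p∩tabulate-f∧≢x∣ S _ j ⟩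
    suc (indegIn (auxDigraph m G) S j)           ∎
    where open ℕ.≤-Reasoning

  ∣RN∩B∣≤∣RN⁺∣ : ∀ {m ν} (G : Graph (m ℕ.+ m)) (S : Subset m) → 0ℚ ≤ ν → 1ℚ ≤ ν * ℕ→ℚ m →
    ∣ RN ν G (liftA S) ∩ setB m ∣ ℕ.≤ ∣ RN⁺ (ν * ½) (auxDigraph m G) S ∣
  ∣RN∩B∣≤∣RN⁺∣ {m} {ν} G S 0≤ν 1≤νm = begin
    ∣ RN ν G (liftA S) ∩ setB m ∣        ≡⟨ ∣tabulate∩⊥++⊤∣ {m} {m} _ ⟩
    ∣ tabulate (λ j → ν * ℕ→ℚ (m ℕ.+ m) ≤ᵇ ℕ→ℚ (degIn G (liftA S) (vB {m} j))) ∣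
                                        ≤⟨ p⊆q⇒∣p∣≤∣q∣ (tabulate-⊆ λ j → ≤⇒≤ᵇ ∘ robust-at j ∘ ≤ᵇ⇒≤) ⟩
    ∣ RN⁺ (ν * ½) (auxDigraph m G) S ∣  ∎
    where
    open ℕ.≤-Reasoning
    robust-at : ∀ j → ν * ℕ→ℚ (m ℕ.+ m) ≤ ℕ→ℚ (degIn G (liftA S) (vB j)) →
                (ν * ½) * ℕ→ℚ m ≤ ℕ→ℚ (indegIn (auxDigraph m G) S j)
    robust-at j νN≤deg = halved-threshold {m = m} 0≤ν 1≤νm νN≤deg (degIn-vB≤1+indegIn G S j)

  expansion-of-liftA : ∀ {m ν τ} (G : Graph (m ℕ.+ m)) → BipRobustExpander ν τ G (setA m) (setB m) →
    ∀ (S : Subset m) → τ * ℕ→ℚ m ≤ ℕ→ℚ ∣ S ∣ → ℕ→ℚ ∣ S ∣ ≤ (1ℚ - τ) * ℕ→ℚ m →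
    ℕ→ℚ ∣ S ∣ + ν * ℕ→ℚ (m ℕ.+ m) ≤ ℕ→ℚ ∣ RN ν G (liftA S) ∩ setB m ∣
  expansion-of-liftA {m} {ν} {τ} G expander S τm≤s s≤[1-τ]m =
    subst (λ s → ℕ→ℚ s + ν * ℕ→ℚ (m ℕ.+ m) ≤ ℕ→ℚ ∣ RN ν G (liftA S) ∩ setB m ∣) ∣S′∣≡∣S∣
      (expander (liftA S) (p++⊥⊆⊤++⊥ S)
        (subst₂ (λ a s → τ * ℕ→ℚ a ≤ ℕ→ℚ s) (sym ∣A∣≡m) (sym ∣S′∣≡∣S∣) τm≤s)
        (subst₂ (λ a s → ℕ→ℚ s ≤ (1ℚ - τ) * ℕ→ℚ a) (sym ∣A∣≡m) (sym ∣S′∣≡∣S∣) s≤[1-τ]m))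
    where
    ∣S′∣≡∣S∣ : ∣ liftA S ∣ ≡ ∣ S ∣
    ∣S′∣≡∣S∣ = ∣p++⊥∣≡∣p∣ S
    ∣A∣≡m : ∣ setA m ∣ ≡ m
    ∣A∣≡m = trans (∣p++⊥∣≡∣p∣ {m} {m} ⊤) (∣⊤∣≡n m)

  window-antimono : ∀ {τ τ′ n s} → 0ℚ ≤ n → τ ≤ τ′ →
    τ′ * n ≤ s → s ≤ (1ℚ - τ′) * n → τ * n ≤ s × s ≤ (1ℚ - τ) * n
  window-antimono {n = n} 0≤n τ≤τ′ τ′n≤s s≤[1-τ′]n =
    ≤-trans (*-monoʳ-≤-nonNeg n {{nonNegative 0≤n}} τ≤τ′) τ′n≤s ,
    ≤-trans s≤[1-τ′]n (*-monoʳ-≤-nonNeg n {{nonNegative 0≤n}} (+-monoʳ-≤ 1ℚ (neg-antimono-≤ τ≤τ′)))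

  robust-outexpansion : ∀ {ν τ m} → 0ℚ < ν → ν ≤ τ → ↧ₙ ν ℕ.≤ m →
    (G : Graph (m ℕ.+ m)) → BipRobustExpander ν τ G (setA m) (setB m) →
    RobustOutexpander (ν * ½) ((ℤ.+ 2 / 1) * τ) (auxDigraph m G)
  robust-outexpansion {ν} {τ} {m} 0<ν ν≤τ ↧ν≤m G expander S 2τm≤s s≤[1-2τ]m = begin
    ℕ→ℚ ∣ S ∣ + (ν * ½) * ℕ→ℚ m              ≤⟨ +-monoʳ-≤ (ℕ→ℚ ∣ S ∣) threshold≤ ⟩
    ℕ→ℚ ∣ S ∣ + ν * ℕ→ℚ (m ℕ.+ m)            ≤⟨ expansion-of-liftA {m} {ν} {τ} G expander S τm≤s s≤[1-τ]m ⟩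
    ℕ→ℚ ∣ RN ν G (liftA S) ∩ setB m ∣        ≤⟨ ℕ→ℚ-mono-≤ (∣RN∩B∣≤∣RN⁺∣ {m} {ν} G S 0≤ν (1≤p*n ν m 0<ν ↧ν≤m)) ⟩
    ℕ→ℚ ∣ RN⁺ (ν * ½) (auxDigraph m G) S ∣   ∎
    where
    open ≤-Reasoning
    0≤ν = <⇒≤ 0<ν
    0≤τ = ≤-trans 0≤ν ν≤τ
    threshold≤ : (ν * ½) * ℕ→ℚ m ≤ ν * ℕ→ℚ (m ℕ.+ m)
    threshold≤ = ≤-trans (halve-*-≤ 0≤ν (0≤ℕ→ℚ m)) (*-monoˡ-≤-nonNeg ν {{nonNegative 0≤ν}} (ℕ→ℚ-mono-≤ (m≤m+n m m)))
    τ-window = window-antimono (0≤ℕ→ℚ m) (p≤2*p 0≤τ) 2τm≤s s≤[1-2τ]m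
    τm≤s = proj₁ τ-window
    s≤[1-τ]m = proj₂ τ-window

open import Defs
open import Data.Nat using (ℕ; _≥_)
open import Data.Rational using (ℚ; 0ℚ; _<_; _≤_; ½; _*_; _/_)
open import Data.Integer using (+_)
open import Data.Product using (Σ; _×_)
open import Data.Product using (_,_)
open import Data.Rational using (↧ₙ_)
open import Data.Rational.Properties using (positive⁻¹)
open RobustNeighbourhoods using (robust-outexpansion)

proposition3p4 : Σ ℚ λ τ₀ → 0ℚ < τ₀ ×
    ((ν τ : ℚ) → 0ℚ < ν → ν ≤ τ → τ ≤ τ₀ → ν ≤ ½ →
    Σ ℕ λ m₀ → (m : ℕ) → m ≥ m₀ →
    (G : Graph (m Data.Nat.+ m)) →
    IsBipartition G (setA m) (setB m) →
    BipRobustExpander ν τ G (setA m) (setB m) →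
    RobustOutexpander (ν * ½) ((+ 2 / 1) * τ) (auxDigraph m G))
proposition3p4 = ½ , positive⁻¹ ½ , λ ν τ 0<ν ν≤τ _ _ →
  ↧ₙ ν , λ m ↧ν≤m G _ → robust-outexpansion 0<ν ν≤τ ↧ν≤m G
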